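{- Let $S$ be a numerical semigroup such that $W_0(S)\ge 0$. Then $W(S)=e|L|-c\ge 0$, i.e. $S$ satisfies Wilf's conjecture.
   Context: A numerical semigroup is a submonoid $S$ of $(\mathbb N,+)$ with $\mathbb N\setminus S$ finite. Let $S^*=S\setminus\{0\}$, $m=\min S^*$, $c$ the least $c\in\mathbb N$ with $[c,\infty[\subseteq S$, $L=S\cap[0,c-1]$, $P$ the minimal generating set (primitive elements: elements of $S^*$ not a sum of two elements of $S^*$), $e=|P|$, $D=S^*\setminus P$, $q=\lceil c/m\rceil$, $\rho=qm-c\in[0,m-1]$, $I_q=[c,c+m-1]$, $D_q=D\cap I_q$. Define $W(S)=e|L|-c$ and $W_0(S)=|P\cap L|\,|L|-q|D_q|+\rho$. -}

module Defs where

open import Data.Bool using (Bool; true; false; _∧_; not; T)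
open import Data.Nat using (ℕ; zero; suc; _+_; _*_; _∸_; _≤_; _<_; NonZero)
open import Data.Nat.DivMod using (_/_)
open import Data.List using (List; length)
open import Data.List.Membership.Propositional using (_∈_)
open import Data.List.Relation.Unary.Unique.Propositional using (Unique)
open import Data.Integer using (ℤ; +_; _-_)
open import Data.Product using (_×_; ∃)
open import Function.Bundles using (_⇔_)
import Data.Integer as ℤ

record NumericalSemigroup : Set where
  field
    mem      : ℕ → Bool
    has-zero : T (mem 0)
    closed   : ∀ a b → T (mem a) → T (mem b) → T (mem (a + b))
    cofinite : ∃ λ N → ∀ n → N ≤ n → T (mem n)
open NumericalSemigroup public

isNonZero : ℕ → Bool
isNonZero zero    = false
isNonZero (suc _) = true

memStar : NumericalSemigroup → ℕ → Bool
memStar S n = mem S n ∧ isNonZero n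

anyBelow : (ℕ → Bool) → ℕ → Bool
anyBelow p zero    = false
anyBelow p (suc k) = p k Data.Bool.∨ anyBelow p k

isDecomposable : NumericalSemigroup → ℕ → Bool
isDecomposable S n = anyBelow (λ a → memStar S a ∧ memStar S (n ∸ a)) n

isPrimitive : NumericalSemigroup → ℕ → Bool
isPrimitive S n = memStar S n ∧ not (isDecomposable S n)

isInD : NumericalSemigroup → ℕ → Bool
isInD S n = memStar S n ∧ not (isPrimitive S n)

IsMultiplicity : NumericalSemigroup → ℕ → Set
IsMultiplicity S m = T (memStar S m) × (∀ x → T (memStar S x) → m ≤ x)

IsConductor : NumericalSemigroup → ℕ → Set
IsConductor S c =
  (∀ n → c ≤ n → T (mem S n)) ×
  (∀ c' → (∀ n → c' ≤ n → T (mem S n)) → c ≤ c')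

Enumerates-P : NumericalSemigroup → List ℕ → Set
Enumerates-P S Ps = Unique Ps × (∀ x → (x ∈ Ps) ⇔ T (isPrimitive S x))

countFrom : (ℕ → Bool) → ℕ → ℕ → ℕ
countFrom p a zero = 0
countFrom p a (suc len) with p a
... | true  = suc (countFrom p (suc a) len)
... | false = countFrom p (suc a) len

ceilDiv : ℕ → (m : ℕ) → .{{NonZero m}} → ℕ
ceilDiv c m = (c + m ∸ 1) / m

sizeL : NumericalSemigroup → ℕ → ℕ
sizeL S c = countFrom (mem S) 0 c

sizePL : NumericalSemigroup → ℕ → ℕ
sizePL S c = countFrom (isPrimitive S) 0 c

sizeDq : NumericalSemigroup → ℕ → ℕ → ℕ
sizeDq S c m = countFrom (isInD S) c m

W : NumericalSemigroup → (e c : ℕ) → ℤ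
W S e c = + (e * sizeL S c) - + c

W₀ : NumericalSemigroup → (c m : ℕ) → .{{NonZero m}} → ℤ
W₀ S c m = (+ (sizePL S c * sizeL S c) - + (q * sizeDq S c m)) ℤ.+ + (q * m ∸ c)
  where q = ceilDiv c m

-- Every primitive element is below c + m (beyond that, x = m + (x - m) with x - m ∈ S*),
-- so e = |P ∩ L| + |P ∩ I_q|, and I_q ⊆ S* splits into P ∩ I_q and D_q, giving
-- |P ∩ I_q| = m - |D_q|.  The multiples 0, m, …, (q-1)m all lie in L, so q ≤ |L|, hence
-- e|L| - c ≥ |P ∩ L| |L| + q (m - |D_q|) - c = W₀(S) ≥ 0.
module Submission where

open import Defs
open import Data.Nat using (ℕ; NonZero)
open import Data.List using (List; length)
open import Data.Integer using (+_; _≤_)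

open import Data.Bool using (true; false; T; not; _∧_)
open import Data.Bool.Properties using (T-∧; T-∨; T-≡)
open import Data.Empty using (⊥-elim)
open import Data.Integer.Properties using (0≤i-j⇒j≤i; i≤j⇒0≤j-i; drop‿+≤+; pos-+)
open import Data.List using (filter; applyUpTo; upTo)
open import Data.List.Membership.Propositional using (_∈_)
open import Data.List.Membership.Propositional.Properties using (∈-filter⁺; ∈-filter⁻; ∈-upTo⁺)
open import Data.List.Membership.Propositional.Properties.WithK using (unique∧set⇒bag)
open import Data.List.Relation.Binary.BagAndSetEquality using (_∼[_]_; bag; ∼bag⇒↭)
open import Data.List.Relation.Binary.Permutation.Propositional.Properties using (↭-length)
open import Data.List.Relation.Unary.Unique.Propositional using (Unique)
open import Data.List.Relation.Unary.Unique.Propositional.Properties using (filter⁺; upTo⁺)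
open import Data.Nat using (zero; suc; _+_; _*_; _∸_; _<_; _<?_; z≤n; s≤s)
open import Data.Nat.DivMod using (_%_; m≡m%n+[m/n]*n; m%n<n; m/n*n≤m)
open import Data.Nat.Properties
open import Data.Product using (_,_; proj₁; proj₂)
open import Data.Sum using (inj₁; inj₂)
open import Data.Unit using (tt)
open import Function using (_∘_)
open import Function.Bundles using (_⇔_; mk⇔; Equivalence)
open import Relation.Binary.PropositionalEquality
open import Relation.Nullary using (¬_; yes; no)
open import Relation.Nullary.Decidable using (T?)
import Data.Integer as ℤ
import Data.Integer.Properties as ℤ
import Data.Nat as ℕ

countFrom-+ : ∀ p a m n → countFrom p a (m + n) ≡ countFrom p a m + countFrom p (a + m) n
countFrom-+ p a zero    n rewrite +-identityʳ a = refl
countFrom-+ p a (suc m) n rewrite +-suc a m with p a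
... | true  = cong suc (countFrom-+ p (suc a) m n)
... | false = countFrom-+ p (suc a) m n

countFrom-mono : ∀ p a {m n} → m ℕ.≤ n → countFrom p a m ℕ.≤ countFrom p a n
countFrom-mono p a {m} {n} m≤n = begin
  countFrom p a m                                      ≤⟨ m≤m+n _ _ ⟩
  countFrom p a m + countFrom p (a + m) (n ∸ m)        ≡⟨ countFrom-+ p a m (n ∸ m) ⟨
  countFrom p a (m + (n ∸ m))                          ≡⟨ cong (countFrom p a) (m+[n∸m]≡n m≤n) ⟩
  countFrom p a n                                      ∎
  where open ≤-Reasoning

countFrom-complement : ∀ p q a n → (∀ x → a ℕ.≤ x → q x ≡ not (p x)) →
  countFrom p a n + countFrom q a n ≡ n
countFrom-complement p q a zero    q≡¬p = refl
countFrom-complement p q a (suc n) q≡¬p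
  with ih ← countFrom-complement p q (suc a) n (λ x → q≡¬p x ∘ <⇒≤)
  with p a | q a | q≡¬p a ≤-refl
... | true  | false | refl = cong suc ih
... | false | true  | refl = trans (+-suc _ _) (cong suc ih)

countFrom-head : ∀ p a n → T (p a) → 1 ℕ.≤ countFrom p a (suc n)
countFrom-head p a n pa with p a
... | true = s≤s z≤n

countFrom-progression : ∀ p a m .{{_ : NonZero m}} k → (∀ i → i ℕ.≤ k → T (p (a + i * m))) →
  suc k ℕ.≤ countFrom p a (suc (k * m))
countFrom-progression p a m zero hit =
  countFrom-head p a 0 (subst (T ∘ p) (+-identityʳ a) (hit 0 z≤n))
countFrom-progression p a m@(suc m-1) (suc k) hit = begin
  suc (suc k)                                              ≤⟨ +-mono-≤ head tail ⟩
  countFrom p a m + countFrom p (a + m) (suc (k * m))      ≡⟨ countFrom-+ p a m (suc (k * m)) ⟨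
  countFrom p a (m + suc (k * m))                          ≡⟨ cong (countFrom p a) (+-suc m (k * m)) ⟩
  countFrom p a (suc (suc k * m))                          ∎
  where
  open ≤-Reasoning
  head : 1 ℕ.≤ countFrom p a m
  head = countFrom-head p a m-1 (subst (T ∘ p) (+-identityʳ a) (hit 0 z≤n))
  tail : suc k ℕ.≤ countFrom p (a + m) (suc (k * m))
  tail = countFrom-progression p (a + m) m k λ i i≤k →
    subst (T ∘ p) (sym (+-assoc a m (i * m))) (hit (suc i) (s≤s i≤k))

countFrom≡length-filter : ∀ p a n (f : ℕ → ℕ) → (∀ i → f i ≡ i + a) →
  countFrom p a n ≡ length (filter (T? ∘ p) (applyUpTo f n))
countFrom≡length-filter p a zero    f f≡ = refl
countFrom≡length-filter p a (suc n) f f≡ rewrite f≡ 0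
  with ih ← countFrom≡length-filter p (suc a) n (f ∘ suc) (λ i → trans (f≡ (suc i)) (sym (+-suc i a)))
  with p a
... | true  = cong suc ih
... | false = ih

length-enumeration : ∀ p N (xs : List ℕ) → Unique xs → (∀ x → (x ∈ xs) ⇔ T (p x)) →
  (∀ x → T (p x) → x < N) → length xs ≡ countFrom p 0 N
length-enumeration p N xs unique enum bounded = begin
  length xs                                ≡⟨ ↭-length (∼bag⇒↭ xs∼filter) ⟩
  length (filter (T? ∘ p) (upTo N))        ≡⟨ countFrom≡length-filter p 0 N (λ i → i) (sym ∘ +-identityʳ) ⟨
  countFrom p 0 N                          ∎
  where
  open ≡-Reasoning
  xs∼filter : xs ∼[ bag ] filter (T? ∘ p) (upTo N)
  xs∼filter = unique∧set⇒bag unique (filter⁺ (T? ∘ p) (upTo⁺ N)) λ {x} → mk⇔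
    (λ x∈xs → let px = Equivalence.to (enum x) x∈xs in ∈-filter⁺ (T? ∘ p) (∈-upTo⁺ (bounded x px)) px)
    (λ x∈filter → Equivalence.from (enum x) (proj₂ (∈-filter⁻ (T? ∘ p) {xs = upTo N} x∈filter)))

ceilDiv*n<m+n : ∀ m n .{{_ : NonZero n}} → ceilDiv m n * n < m + n
ceilDiv*n<m+n m n@(suc n-1) = begin-strict
  ceilDiv m n * n   ≤⟨ m/n*n≤m (m + n ∸ 1) n ⟩
  m + n ∸ 1         ≡⟨ cong (_∸ 1) (+-suc m n-1) ⟩
  m + n-1           <⟨ +-monoʳ-< m ≤-refl ⟩
  m + n             ∎
  where open ≤-Reasoning

m≤ceilDiv*n : ∀ m n .{{_ : NonZero n}} → m ℕ.≤ ceilDiv m n * n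
m≤ceilDiv*n m n@(suc n-1) = +-cancelʳ-≤ n-1 m (ceilDiv m n * n) (begin
  m + n-1                              ≡⟨ cong (_∸ 1) (+-suc m n-1) ⟨
  m + n ∸ 1                            ≡⟨ m≡m%n+[m/n]*n (m + n ∸ 1) n ⟩
  (m + n ∸ 1) % n + ceilDiv m n * n    ≤⟨ +-monoˡ-≤ _ (<⇒≤pred (m%n<n (m + n ∸ 1) n)) ⟩
  n-1 + ceilDiv m n * n                ≡⟨ +-comm n-1 _ ⟩
  ceilDiv m n * n + n-1                ∎)
  where open ≤-Reasoning

-- pL, pI, dq play the roles of |P ∩ L|, |P ∩ I_q| and |D_q|.
wilf-arithmetic : ∀ {c m q L e pL pI dq} → e ≡ pL + pI → pI + dq ≡ m → q ℕ.≤ L →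
  c ℕ.≤ q * m → q * dq ℕ.≤ pL * L + (q * m ∸ c) → c ℕ.≤ e * L
wilf-arithmetic {c} {m} {q} {L} {e} {pL} {pI} {dq} refl refl q≤L c≤qm w₀ = begin
  c                   ≤⟨ +-cancelʳ-≤ (q * dq) c (pL * L + q * pI) c+qdq≤ ⟩
  pL * L + q * pI     ≤⟨ +-monoʳ-≤ (pL * L) (*-monoˡ-≤ pI q≤L) ⟩
  pL * L + L * pI     ≡⟨ cong (_+_ (pL * L)) (*-comm L pI) ⟩
  pL * L + pI * L     ≡⟨ *-distribʳ-+ L pL pI ⟨
  (pL + pI) * L       ∎
  where
  open ≤-Reasoning
  c+qdq≤ : c + q * dq ℕ.≤ pL * L + q * pI + q * dq
  c+qdq≤ = begin
    c + q * dq                     ≡⟨ +-comm c (q * dq) ⟩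
    q * dq + c                     ≤⟨ +-monoˡ-≤ c w₀ ⟩
    pL * L + (q * m ∸ c) + c       ≡⟨ +-assoc (pL * L) (q * m ∸ c) c ⟩
    pL * L + (q * m ∸ c + c)       ≡⟨ cong (_+_ (pL * L)) (m∸n+n≡m c≤qm) ⟩
    pL * L + q * (pI + dq)         ≡⟨ cong (_+_ (pL * L)) (*-distribˡ-+ q pI dq) ⟩
    pL * L + (q * pI + q * dq)     ≡⟨ +-assoc (pL * L) (q * pI) (q * dq) ⟨
    pL * L + q * pI + q * dq       ∎

0≤[a-b]+r⇒b≤a+r : ∀ a b r → + 0 ≤ (+ a ℤ.- + b) ℤ.+ + r → b ℕ.≤ a + r
0≤[a-b]+r⇒b≤a+r a b r 0≤w = drop‿+≤+ (0≤i-j⇒j≤i (subst (+ 0 ≤_) regroup 0≤w))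
  where
  open ≡-Reasoning
  regroup : (+ a ℤ.- + b) ℤ.+ + r ≡ + (a + r) ℤ.- + b
  regroup = begin
    (+ a ℤ.- + b) ℤ.+ + r       ≡⟨ ℤ.+-assoc (+ a) (ℤ.- + b) (+ r) ⟩
    + a ℤ.+ (ℤ.- + b ℤ.+ + r)   ≡⟨ cong (ℤ._+_ (+ a)) (ℤ.+-comm (ℤ.- + b) (+ r)) ⟩
    + a ℤ.+ (+ r ℤ.- + b)       ≡⟨ ℤ.+-assoc (+ a) (+ r) (ℤ.- + b) ⟨
    (+ a ℤ.+ + r) ℤ.- + b       ≡⟨ cong (ℤ._- + b) (pos-+ a r) ⟨
    + (a + r) ℤ.- + b           ∎

anyBelow-intro : ∀ f {a k} → T (f a) → a < k → T (anyBelow f k)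
anyBelow-intro f {a} {suc k} fa a<1+k with m<1+n⇒m<n∨m≡n a<1+k
... | inj₁ a<k  = Equivalence.from T-∨ (inj₂ (anyBelow-intro f fa a<k))
... | inj₂ refl = Equivalence.from T-∨ (inj₁ fa)

primitive⇒indecomposable : ∀ S x → T (isPrimitive S x) → ¬ T (isDecomposable S x)
primitive⇒indecomposable S x prim dec with memStar S x | isDecomposable S x
... | true  | false = dec
... | false | _     = prim

module MultiplicityConductor (S : NumericalSemigroup) {m c : ℕ} .{{_ : NonZero m}}
  (hm : IsMultiplicity S m) (hc : IsConductor S c) (c>0 : 0 < c) where

  multiple∈S : ∀ i → T (mem S (i * m))
  multiple∈S zero    = has-zero S
  multiple∈S (suc i) = closed S m (i * m) (proj₁ (Equivalence.to T-∧ (proj₁ hm))) (multiple∈S i)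

  memStar-≥c : ∀ {x} → c ℕ.≤ x → T (memStar S x)
  memStar-≥c {zero}  c≤0 = ⊥-elim (n≮0 (<-≤-trans c>0 c≤0))
  memStar-≥c {suc x} c≤x = Equivalence.from T-∧ (proj₁ hc (suc x) c≤x , tt)

  isInD-≥c : ∀ x → c ℕ.≤ x → isInD S x ≡ not (isPrimitive S x)
  isInD-≥c x c≤x = cong (_∧ not (isPrimitive S x)) (Equivalence.to T-≡ (memStar-≥c c≤x))

  primitive<c+m : ∀ x → T (isPrimitive S x) → x < c + m
  primitive<c+m x prim with x <? c + m
  ... | yes x<c+m = x<c+m
  ... | no  x≮c+m = ⊥-elim (primitive⇒indecomposable S x prim
        (anyBelow-intro _ (Equivalence.from T-∧ (proj₁ hm , memStar-≥c c≤x-m)) (<-≤-trans (m<n+m m c>0) c+m≤x)))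
    where
    c+m≤x : c + m ℕ.≤ x
    c+m≤x = ≮⇒≥ x≮c+m
    c≤x-m : c ℕ.≤ x ∸ m
    c≤x-m = subst (ℕ._≤ x ∸ m) (m+n∸n≡m c m) (∸-monoˡ-≤ m c+m≤x)

  length-generators : ∀ Ps → Enumerates-P S Ps →
    length Ps ≡ sizePL S c + countFrom (isPrimitive S) c m
  length-generators Ps (unique , enum) = trans
    (length-enumeration (isPrimitive S) (c + m) Ps unique enum primitive<c+m)
    (countFrom-+ (isPrimitive S) 0 c m)

  primitive+Dq≡m : countFrom (isPrimitive S) c m + sizeDq S c m ≡ m
  primitive+Dq≡m = countFrom-complement (isPrimitive S) (isInD S) c m isInD-≥c

  k*m<c+m⇒k≤sizeL : ∀ k → k * m < c + m → k ℕ.≤ sizeL S c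
  k*m<c+m⇒k≤sizeL zero    _        = z≤n
  k*m<c+m⇒k≤sizeL (suc j) k*m<c+m = begin
    suc j                             ≤⟨ countFrom-progression (mem S) 0 m j (λ i _ → multiple∈S i) ⟩
    countFrom (mem S) 0 (suc (j * m)) ≤⟨ countFrom-mono (mem S) 0 jm<c ⟩
    sizeL S c                         ∎
    where
    open ≤-Reasoning
    jm<c : j * m < c
    jm<c = +-cancelʳ-< m (j * m) c (subst (_< c + m) (+-comm m (j * m)) k*m<c+m)

corollary2p8 : (S : NumericalSemigroup) (m c : ℕ) .{{_ : NonZero m}} (Ps : List ℕ) →
    IsMultiplicity S m → IsConductor S c → Enumerates-P S Ps →
    + 0 ≤ W₀ S c m → + 0 ≤ W S (length Ps) c
corollary2p8 S m zero      Ps hm hc hP w₀≥0 = i≤j⇒0≤j-i (ℤ.+≤+ z≤n)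
corollary2p8 S m c@(suc _) Ps hm hc hP w₀≥0 = i≤j⇒0≤j-i (ℤ.+≤+ (wilf-arithmetic
  (length-generators Ps hP)
  primitive+Dq≡m
  (k*m<c+m⇒k≤sizeL q (ceilDiv*n<m+n c m))
  (m≤ceilDiv*n c m)
  (0≤[a-b]+r⇒b≤a+r (sizePL S c * sizeL S c) (q * sizeDq S c m) (q * m ∸ c) w₀≥0)))
  where
  open MultiplicityConductor S hm hc (s≤s z≤n)
  q : ℕ
  q = ceilDiv c m
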